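{- Let $\mathcal{G}$ be a hereditary class of graphs with a finite set of forbidden induced subgraphs. Then the edge-add class $\mathcal{G}^{+}$ of $\mathcal{G}$ is hereditary and also has a finite set of forbidden induced subgraphs.
   Context: All graphs are simple, finite and undirected. An induced subgraph of $G$ is a graph obtained from $G$ by a sequence of vertex deletions. A class of graphs is hereditary if it is closed under taking induced subgraphs. For a hereditary class $\mathcal{G}$, a forbidden induced subgraph for $\mathcal{G}$ is a graph $H$ not in $\mathcal{G}$ all of whose proper induced subgraphs are in $\mathcal{G}$. A non-edge of $G$ is an edge of the complement $\overline{G}$; for a non-edge $e$, $G+e$ is the graph obtained by adding $e$. The edge-add class $\mathcal{G}^{+}$ of $\mathcal{G}$ is the class of graphs $G$ such that $G\in\mathcal{G}$ or $G$ has a non-edge $e$ with $G+e\in\mathcal{G}$. -}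

module Defs where

open import Data.Nat using (ℕ; _<_)
open import Data.Fin using (Fin; _≟_)
open import Data.Bool using (Bool; true; false; _∨_; _∧_)
open import Data.Bool.Properties using (∨-comm; ∧-comm)
open import Data.Empty using (⊥-elim)
open import Data.Product using (Σ; _×_; _,_)
open import Data.Sum using (_⊎_)
open import Data.List using (List)
open import Data.List.Membership.Propositional using (_∈_)
open import Function.Definitions using (Injective; Bijective)
open import Relation.Binary.PropositionalEquality
open import Relation.Nullary using (¬_; yes; no)
open import Relation.Nullary.Decidable using (⌊_⌋)

record Graph : Set where
  constructor graph
  field
    size       : ℕ
    adj        : Fin size → Fin size → Bool
    adj-sym    : ∀ x y → adj x y ≡ adj y x
    adj-irrefl : ∀ x → adj x x ≡ false
open Graph public

_≼_ : Graph → Graph → Set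
H ≼ G = Σ (Fin (size H) → Fin (size G)) λ f →
          Injective _≡_ _≡_ f × (∀ x y → adj G (f x) (f y) ≡ adj H x y)

_≅_ : Graph → Graph → Set
H ≅ G = Σ (Fin (size H) → Fin (size G)) λ f →
          Bijective _≡_ _≡_ f × (∀ x y → adj G (f x) (f y) ≡ adj H x y)

GraphClass : Set₁
GraphClass = Graph → Set

Hereditary : GraphClass → Set
Hereditary 𝒢 = ∀ G H → 𝒢 G → H ≼ G → 𝒢 H

Forbidden : GraphClass → Graph → Set
Forbidden 𝒢 H = ¬ 𝒢 H × (∀ H′ → H′ ≼ H → size H′ < size H → 𝒢 H′)

HasFiniteForbidden : GraphClass → Set
HasFiniteForbidden 𝒢 =
  Σ (List Graph) λ L → ∀ H → Forbidden 𝒢 H → Σ Graph λ F → F ∈ L × H ≅ F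

module _ (G : Graph) (u v : Fin (size G)) (u≢v : ¬ u ≡ v) where
  private
    a : Fin (size G) → Fin (size G) → Bool
    a x y = adj G x y ∨ ((⌊ x ≟ u ⌋ ∧ ⌊ y ≟ v ⌋) ∨ (⌊ x ≟ v ⌋ ∧ ⌊ y ≟ u ⌋))

    a-sym : ∀ x y → a x y ≡ a y x
    a-sym x y rewrite adj-sym G x y
                    | ∧-comm ⌊ x ≟ u ⌋ ⌊ y ≟ v ⌋
                    | ∧-comm ⌊ x ≟ v ⌋ ⌊ y ≟ u ⌋ =
      cong (adj G y x ∨_) (∨-comm (⌊ y ≟ v ⌋ ∧ ⌊ x ≟ u ⌋) (⌊ y ≟ u ⌋ ∧ ⌊ x ≟ v ⌋))

    a-irrefl : ∀ x → a x x ≡ false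
    a-irrefl x rewrite adj-irrefl G x with x ≟ u | x ≟ v
    ... | yes p | yes q = ⊥-elim (u≢v (trans (sym p) q))
    ... | yes _ | no _  = refl
    ... | no _  | yes _ = refl
    ... | no _  | no _  = refl

  addEdge : Graph
  addEdge = graph (size G) a a-sym a-irrefl

EdgeAdd : GraphClass → GraphClass
EdgeAdd 𝒢 G = 𝒢 G ⊎
  Σ (Fin (size G)) λ u → Σ (Fin (size G)) λ v → Σ (¬ u ≡ v) λ u≢v →
    adj G u v ≡ false × 𝒢 (addEdge G u v u≢v)

{-# OPTIONS --safe #-}
module Submission where

-- Let every forbidden induced subgraph of 𝒢 have at most k vertices. An
-- induced subgraph of G + uv either contains both u and v, and then it is
-- an induced subgraph of G plus a non-edge, or it does not see the new edge
-- at all; so 𝒢⁺ is hereditary. Now let H be forbidden for 𝒢⁺. Since H ∉ 𝒢,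
-- H contains a forbidden graph F₁ of 𝒢, and for each non-edge ab of H with
-- a, b in F₁, H + ab ∉ 𝒢 contains a forbidden graph F_ab of 𝒢. If H had more
-- than k + k³ vertices, some vertex v would lie outside F₁ and all F_ab.
-- Then H − v ∈ 𝒢⁺ by minimality of H, yet F₁ ⊆ H − v, and for every
-- non-edge cd of H − v one of F₁ (if c or d is outside F₁) or F_cd survives
-- in (H − v) + cd. So forbidden graphs of 𝒢⁺ have at most k + k³ vertices,
-- and there are only finitely many such graphs up to isomorphism.
--
-- As 𝒢 is an arbitrary predicate, the subgraphs F₁ and F_ab can only be
-- found under a double negation; this suffices because the bound on the
-- number of vertices of H is decidable.

open import Defs
open import Data.Bool using (Bool; true; false; _∨_; _∧_; if_then_else_)
open import Data.Bool.Properties using (∨-comm; ∨-idem; ∨-identityʳ; ∧-zeroʳ)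
  renaming (_≟_ to _≟ᵇ_)
open import Data.Empty using (⊥)
open import Data.Fin using (Fin; zero; suc; _≟_; punchIn; punchOut)
open import Data.Fin.Properties
  using (all?; ¬∀⟶∃¬; ∀-cons; pigeonhole; <⇒≢; punchIn-injective; punchIn-punchOut; injective⇒≤)
open import Data.List
  using (List; []; _∷_; [_]; _++_; length; map; tabulate; concat; concatMap; upTo; lookup; cartesianProductWith)
open import Data.List.Extrema.Nat using (max; xs≤max)
open import Data.List.Membership.Propositional using (_∈_; _∉_)
open import Data.List.Membership.Propositional.Properties
  using (∈-++⁺ˡ; ∈-++⁺ʳ; ∈-concat⁺′; ∈-map⁺; ∈-tabulate⁺; ∈-tabulate⁻; ∈-upTo⁺; ∈-cartesianProductWith⁺)
import Data.List.Membership.DecPropositional as DecMembership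
open import Data.List.Properties using (length-++; length-tabulate)
open import Data.List.Relation.Unary.All as All using ()
open import Data.List.Relation.Unary.Any using (here; there; index)
open import Data.List.Relation.Unary.Any.Properties using (lookup-index)
open import Data.Nat using (ℕ; zero; suc; pred; _+_; _*_; _≤_; _<_; _≤?_; z≤n; s≤s)
open import Data.Nat.Induction using (<-wellFounded)
open import Data.Nat.Properties
  using (≤-trans; ≤-reflexive; ≤-<-trans; +-mono-≤; *-mono-≤; *-monoˡ-≤; ≮⇒≥; n<1+n)
open import Data.Product using (Σ; ∃; _×_; _,_; proj₁; proj₂)
open import Data.Sum as Sum using (_⊎_; inj₁; inj₂)
open import Data.Vec.Functional using () renaming (_∷_ to _◂_)
open import Effect.Monad using (RawMonad)
open import Function using (id; _∘_; _on_; mk⇔)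
open import Function.Construct.Identity using (bijective)
open import Function.Definitions using (Injective)
open import Induction.WellFounded using (Acc; acc)
open import Level using (0ℓ)
open import Relation.Binary.Construct.On using (wellFounded)
open import Relation.Binary.PropositionalEquality
  using (_≡_; _≢_; refl; sym; trans; cong; cong₂; subst; module ≡-Reasoning)
open import Relation.Nullary using (¬_; Dec; yes; no; contradiction)
open import Relation.Nullary.Decidable
  using (⌊_⌋; ¬?; _×-dec_; toSum; decidable-stable; does-⇔; isYes≗does; ¬¬-excluded-middle)
open import Relation.Nullary.Negation using (¬¬-Monad)

open RawMonad (¬¬-Monad {a = 0ℓ})

private
  variable
    A : Set
    n m : ℕ
    F G H K : Graph

_∈?_ : (v : Fin n) (xs : List (Fin n)) → Dec (v ∈ xs)
_∈?_ = DecMembership._∈?_ _≟_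

⋃ : (Fin n → List A) → List A
⋃ f = concat (tabulate f)

∈-⋃⁺ : ∀ {f : Fin n → List A} {x} i → x ∈ f i → x ∈ ⋃ f
∈-⋃⁺ i x∈ = ∈-concat⁺′ x∈ (∈-tabulate⁺ i)

length-⋃ : ∀ {f : Fin n → List A} → (∀ i → length (f i) ≤ m) → length (⋃ f) ≤ n * m
length-⋃ {zero}  _     = z≤n
length-⋃ {suc n} {f = f} short =
  ≤-trans (≤-reflexive (length-++ (f zero))) (+-mono-≤ (short zero) (length-⋃ (short ∘ suc)))

∉-tabulate : ∀ {f : Fin n → A} {x} → x ∉ tabulate f → ∀ i → f i ≢ x
∉-tabulate x∉ i refl = x∉ (∈-tabulate⁺ i)

length<⇒∃∉ : (xs : List (Fin n)) → length xs < n → ∃ (_∉ xs)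
length<⇒∃∉ {n} xs xs<n with all? {n} (_∈? xs)
... | no ¬all  = ¬∀⟶∃¬ n (_∈ xs) (_∈? xs) ¬all
... | yes all∈ =
  let (i , j , i<j , same-position) = pigeonhole xs<n (λ v → index (all∈ v))
  in contradiction (trans (lookup-index (all∈ i))
                     (trans (cong (lookup xs) same-position) (sym (lookup-index (all∈ j)))))
                   (<⇒≢ i<j)

¬¬-Π : ∀ n {P : Fin n → Set} → (∀ i → ¬ ¬ P i) → ¬ ¬ (∀ i → P i)
¬¬-Π zero    _   = pure λ ()
¬¬-Π (suc n) ¬¬P = ∀-cons <$> ¬¬P zero ⊛ ¬¬-Π n (¬¬P ∘ suc)

¬¬-∀⊎∃¬ : ∀ n (P : Fin n → Set) → ¬ ¬ ((∀ i → P i) ⊎ ∃ λ i → ¬ P i)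
¬¬-∀⊎∃¬ n P = do
  P? ← ¬¬-Π n (λ _ → ¬¬-excluded-middle)
  pure (Sum.map₂ (¬∀⟶∃¬ n P P?) (toSum (all? P?)))

≼-refl : G ≼ G
≼-refl = id , id , λ _ _ → refl

≼-trans : F ≼ G → G ≼ K → F ≼ K
≼-trans (f , f-inj , f-adj) (g , g-inj , g-adj) =
  g ∘ f , (λ gfx≡gfy → f-inj (g-inj gfx≡gfy)) , λ x y → trans (g-adj (f x) (f y)) (f-adj x y)

proper⇒∃∉image : (e : F ≼ G) → size F < size G → ∃ (_∉ tabulate (proj₁ e))
proper⇒∃∉image {G = G} (f , _) F<G =
  length<⇒∃∉ (tabulate f) (subst (_< size G) (sym (length-tabulate f)) F<G)

skip : Fin n → Fin (pred n) → Fin n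
skip {suc _} = punchIn

skip-injective : (v : Fin n) → Injective _≡_ _≡_ (skip v)
skip-injective {suc _} v = punchIn-injective v _ _

skip-covers : ∀ {v w : Fin n} → w ≢ v → ∃ λ x → skip v x ≡ w
skip-covers {suc _} w≢v = punchOut (w≢v ∘ sym) , punchIn-punchOut _

infixl 30 _∖_
_∖_ : (G : Graph) → Fin (size G) → Graph
G ∖ v = graph (pred (size G)) (λ x y → adj G (skip v x) (skip v y))
  (λ x y → adj-sym G (skip v x) (skip v y)) (λ x → adj-irrefl G (skip v x))

∖-≼ : ∀ {v} → G ∖ v ≼ G
∖-≼ {v = v} = skip v , skip-injective v , λ _ _ → refl

∖-size : (v : Fin (size G)) → size (G ∖ v) < size G
∖-size {G} v with size G
... | suc n = n<1+n n

≼-∖ : ∀ {v} (e : F ≼ G) → v ∉ tabulate (proj₁ e) → F ≼ G ∖ v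
≼-∖ {F} {G} {v} (f , f-inj , f-adj) v∉ = g , g-inj , g-adj
  where
    covered : ∀ x → ∃ λ y → skip v y ≡ f x
    covered x = skip-covers (∉-tabulate v∉ x)

    g : Fin (size F) → Fin (pred (size G))
    g x = proj₁ (covered x)

    g-inj : Injective _≡_ _≡_ g
    g-inj {x} {y} gx≡gy =
      f-inj (trans (sym (proj₂ (covered x))) (trans (cong (skip v) gx≡gy) (proj₂ (covered y))))

    g-adj : ∀ x y → adj G (skip v (g x)) (skip v (g y)) ≡ adj F x y
    g-adj x y = trans (cong₂ (adj G) (proj₂ (covered x)) (proj₂ (covered y))) (f-adj x y)

NonEdge : (G : Graph) → Fin (size G) → Fin (size G) → Set
NonEdge G a b = a ≢ b × adj G a b ≡ false

nonEdge? : (G : Graph) (a b : Fin (size G)) → Dec (NonEdge G a b)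
nonEdge? G a b = ¬? (a ≟ b) ×-dec (adj G a b ≟ᵇ false)

addEdge-≼ : ∀ {a b} (e : F ≼ G) (p : a ≢ b) (q : proj₁ e a ≢ proj₁ e b) →
            addEdge F a b p ≼ addEdge G (proj₁ e a) (proj₁ e b) q
addEdge-≼ {a = a} {b} (f , f-inj , f-adj) p q = f , f-inj , λ x y →
  cong₂ _∨_ (f-adj x y)
    (cong₂ _∨_ (cong₂ _∧_ (≟-preserved x a) (≟-preserved y b))
               (cong₂ _∧_ (≟-preserved x b) (≟-preserved y a)))
  where
    ≟-preserved : ∀ x y → ⌊ f x ≟ f y ⌋ ≡ ⌊ x ≟ y ⌋
    ≟-preserved x y = trans (isYes≗does (f x ≟ f y))
      (trans (does-⇔ (mk⇔ f-inj (cong f)) (f x ≟ f y) (x ≟ y)) (sym (isYes≗does (x ≟ y))))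

≼-addEdge-missing : ∀ {a b} (e : F ≼ G) (p : a ≢ b) →
                    a ∉ tabulate (proj₁ e) ⊎ b ∉ tabulate (proj₁ e) → F ≼ addEdge G a b p
≼-addEdge-missing {G = G} {a} {b} (f , f-inj , f-adj) p missing =
  f , f-inj , λ x y → trans (cong (adj G (f x) (f y) ∨_) (no-new-edge x y missing))
                            (trans (∨-identityʳ _) (f-adj x y))
  where
    no-new-edge : ∀ x y → a ∉ tabulate f ⊎ b ∉ tabulate f →
                  (⌊ f x ≟ a ⌋ ∧ ⌊ f y ≟ b ⌋) ∨ (⌊ f x ≟ b ⌋ ∧ ⌊ f y ≟ a ⌋) ≡ false
    no-new-edge x y (inj₁ a∉) with f x ≟ a | f y ≟ a
    ... | yes fx≡a | _        = contradiction fx≡a (∉-tabulate a∉ x)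
    ... | no _     | yes fy≡a = contradiction fy≡a (∉-tabulate a∉ y)
    ... | no _     | no _     = ∧-zeroʳ ⌊ f x ≟ b ⌋
    no-new-edge x y (inj₂ b∉) with f x ≟ b | f y ≟ b
    ... | yes fx≡b | _        = contradiction fx≡b (∉-tabulate b∉ x)
    ... | no _     | yes fy≡b = contradiction fy≡b (∉-tabulate b∉ y)
    ... | no _     | no _     = trans (∨-identityʳ _) (∧-zeroʳ ⌊ f x ≟ a ⌋)

∖-addEdge : ∀ {v c d} (p : c ≢ d) (q : skip v c ≢ skip v d) →
            addEdge G (skip v c) (skip v d) q ∖ v ≼ addEdge (G ∖ v) c d p
∖-addEdge {G} {v} p q =
  id , id , λ x y → sym (proj₂ (proj₂ (addEdge-≼ {F = G ∖ v} {G = G} (∖-≼ {G} {v}) p q)) x y)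

allFunctions : ∀ n → List A → List (Fin n → A)
allFunctions zero    xs = [ (λ ()) ]
allFunctions (suc n) xs = cartesianProductWith _◂_ xs (allFunctions n xs)

allFunctions-complete : ∀ {xs : List A} (R : A → A → Set) → (∀ a → ∃ λ a′ → a′ ∈ xs × R a a′) →
                        ∀ n (f : Fin n → A) → ∃ λ g → g ∈ allFunctions n xs × (∀ i → R (f i) (g i))
allFunctions-complete R approx zero    f = (λ ()) , here refl , λ ()
allFunctions-complete R approx (suc n) f =
  let (a′ , a′∈ , Ra) = approx (f zero)
      (g , g∈ , Rg)   = allFunctions-complete R approx n (f ∘ suc)
  in a′ ◂ g , ∈-cartesianProductWith⁺ _◂_ a′∈ g∈ , ∀-cons Ra Rg

adjacencies : ∀ n → List (Fin n → Fin n → Bool)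
adjacencies n = allFunctions n (allFunctions n (true ∷ false ∷ []))

adjacencies-complete : ∀ n (b : Fin n → Fin n → Bool) →
                       ∃ λ b′ → b′ ∈ adjacencies n × (∀ x y → b x y ≡ b′ x y)
adjacencies-complete n = allFunctions-complete (λ f g → ∀ y → f y ≡ g y)
  (allFunctions-complete _≡_ (λ where true  → true  , here refl , refl
                                      false → false , there (here refl) , refl) n) n

symmetrise : (Fin n → Fin n → Bool) → Fin n → Fin n → Bool
symmetrise b x y = if ⌊ x ≟ y ⌋ then false else b x y ∨ b y x

symmetrise-sym : (b : Fin n → Fin n → Bool) → ∀ x y → symmetrise b x y ≡ symmetrise b y x
symmetrise-sym b x y with x ≟ y | y ≟ x
... | yes _   | yes _   = refl
... | no _    | no _    = ∨-comm (b x y) (b y x)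
... | yes x≡y | no y≢x  = contradiction (sym x≡y) y≢x
... | no x≢y  | yes y≡x = contradiction (sym y≡x) x≢y

symmetrise-irrefl : (b : Fin n → Fin n → Bool) → ∀ x → symmetrise b x x ≡ false
symmetrise-irrefl b x with x ≟ x
... | yes _   = refl
... | no x≢x  = contradiction refl x≢x

symmetrise-adj : ∀ H {b} → (∀ x y → adj H x y ≡ b x y) → ∀ x y → symmetrise b x y ≡ adj H x y
symmetrise-adj H {b} adj≗b x y with x ≟ y
... | yes refl = sym (adj-irrefl H x)
... | no _     = begin
  b x y ∨ b y x             ≡⟨ sym (cong₂ _∨_ (adj≗b x y) (adj≗b y x)) ⟩
  adj H x y ∨ adj H y x     ≡⟨ cong (adj H x y ∨_) (adj-sym H y x) ⟩
  adj H x y ∨ adj H x y     ≡⟨ ∨-idem (adj H x y) ⟩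
  adj H x y                 ∎
  where open ≡-Reasoning

fromAdjacency : ∀ n → (Fin n → Fin n → Bool) → Graph
fromAdjacency n b = graph n (symmetrise b) (symmetrise-sym b) (symmetrise-irrefl b)

graphsOfSize : ℕ → List Graph
graphsOfSize n = map (fromAdjacency n) (adjacencies n)

graphsOfSize-complete : ∀ H → ∃ λ F → F ∈ graphsOfSize (size H) × H ≅ F
graphsOfSize-complete H =
  let (b , b∈ , adj≗b) = adjacencies-complete (size H) (adj H)
  in fromAdjacency (size H) b , ∈-map⁺ (fromAdjacency (size H)) b∈ ,
     id , bijective _≡_ , symmetrise-adj H adj≗b

graphsUpTo : ℕ → List Graph
graphsUpTo N = concatMap graphsOfSize (upTo (suc N))

graphsUpTo-complete : ∀ {N} H → size H ≤ N → ∃ λ F → F ∈ graphsUpTo N × H ≅ F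
graphsUpTo-complete H H≤N =
  let (F , F∈ , H≅F) = graphsOfSize-complete H
  in F , ∈-concat⁺′ F∈ (∈-map⁺ graphsOfSize (∈-upTo⁺ (s≤s H≤N))) , H≅F

BoundedForbidden : GraphClass → ℕ → Set
BoundedForbidden 𝒢 k = ∀ H → Forbidden 𝒢 H → size H ≤ k

finite⇒bounded : ∀ {𝒢} → HasFiniteForbidden 𝒢 → ∃ (BoundedForbidden 𝒢)
finite⇒bounded (L , cover) = max 0 (map size L) , λ H H-forbidden →
  let (F , F∈L , f , (f-inj , _) , _) = cover H H-forbidden
  in ≤-trans (injective⇒≤ f-inj) (All.lookup (xs≤max 0 (map size L)) (∈-map⁺ size F∈L))

bounded⇒finite : ∀ {𝒢 k} → BoundedForbidden 𝒢 k → HasFiniteForbidden 𝒢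
bounded⇒finite {k = k} bounded =
  graphsUpTo k , λ H H-forbidden → graphsUpTo-complete H (bounded H H-forbidden)

module _ {𝒢 : GraphClass} (hereditary : Hereditary 𝒢) where

  ∉-≼ : F ≼ G → ¬ 𝒢 F → ¬ 𝒢 G
  ∉-≼ F≼G F∉ G∈ = F∉ (hereditary _ _ G∈ F≼G)

  deletions⇒forbidden : ¬ 𝒢 H → (∀ v → 𝒢 (H ∖ v)) → Forbidden 𝒢 H
  deletions⇒forbidden {H} H∉ deletions∈ = H∉ , λ H′ H′≼H H′<H →
    let (v , v∉) = proper⇒∃∉image {H′} {H} H′≼H H′<H
    in hereditary (H ∖ v) H′ (deletions∈ v) (≼-∖ {H′} {H} H′≼H v∉)

  ¬¬forbidden-≼-acc : Acc (_<_ on size) H → ¬ 𝒢 H → ¬ ¬ (∃ λ F → F ≼ H × Forbidden 𝒢 F)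
  ¬¬forbidden-≼-acc {H} (acc smaller) H∉ = ¬¬-∀⊎∃¬ (size H) (λ v → 𝒢 (H ∖ v)) >>= λ where
    (inj₁ deletions∈) → pure (H , ≼-refl {H} , deletions⇒forbidden H∉ deletions∈)
    (inj₂ (v , H∖v∉)) →
      (λ (F , F≼H∖v , F-forbidden) → F , ≼-trans {F} {H ∖ v} {H} F≼H∖v (∖-≼ {H} {v}) , F-forbidden)
      <$> ¬¬forbidden-≼-acc (smaller (∖-size {H} v)) H∖v∉

  ¬¬forbidden-≼ : ¬ 𝒢 H → ¬ ¬ (∃ λ F → F ≼ H × Forbidden 𝒢 F)
  ¬¬forbidden-≼ = ¬¬forbidden-≼-acc (wellFounded size <-wellFounded _)

  EdgeAdd-hereditary : Hereditary (EdgeAdd 𝒢)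
  EdgeAdd-hereditary G H (inj₁ G∈) H≼G = inj₁ (hereditary G H G∈ H≼G)
  EdgeAdd-hereditary G H (inj₂ (u , v , u≢v , uv∉E , G+uv∈)) H≼G@(f , f-inj , f-adj)
    with u ∈? tabulate f | v ∈? tabulate f
  ... | no u∉   | _       = inj₁ (hereditary _ H G+uv∈ (≼-addEdge-missing {H} {G} H≼G u≢v (inj₁ u∉)))
  ... | yes _   | no v∉   = inj₁ (hereditary _ H G+uv∈ (≼-addEdge-missing {H} {G} H≼G u≢v (inj₂ v∉)))
  ... | yes u∈  | yes v∈  with ∈-tabulate⁻ u∈ | ∈-tabulate⁻ v∈
  ...   | a , refl | b , refl = inj₂ (a , b , a≢b , trans (sym (f-adj a b)) uv∉E ,
                                      hereditary _ _ G+uv∈ (addEdge-≼ {H} {G} H≼G a≢b u≢v))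
    where
      a≢b : a ≢ b
      a≢b a≡b = u≢v (cong f a≡b)

module _ {𝒢 : GraphClass} (hereditary : Hereditary 𝒢) {k : ℕ} (bounded : BoundedForbidden 𝒢 k) where

  record Obstruction (G : Graph) : Set where
    constructor obstruction
    field
      core      : Graph
      embedding : core ≼ G
      small     : size core ≤ k
      core∉     : ¬ 𝒢 core

    vertex : Fin (size core) → Fin (size G)
    vertex = proj₁ embedding

    support : List (Fin (size G))
    support = tabulate vertex

    length-support : length support ≤ k
    length-support = ≤-trans (≤-reflexive (length-tabulate vertex)) small

  open Obstruction

  ¬¬obstruction : ¬ 𝒢 G → ¬ ¬ Obstruction G
  ¬¬obstruction G∉ =
    (λ (F , F≼G , F-forbidden) → obstruction F F≼G (bounded F F-forbidden) (proj₁ F-forbidden))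
    <$> ¬¬forbidden-≼ hereditary G∉

  obstruction⇒∉ : Obstruction G → ¬ 𝒢 G
  obstruction⇒∉ {G} O = ∉-≼ hereditary {core O} {G} (embedding O) (core∉ O)

  obstruction-≼ : G ≼ K → Obstruction G → Obstruction K
  obstruction-≼ {G} {K} G≼K O =
    obstruction (core O) (≼-trans {core O} {G} {K} (embedding O) G≼K) (small O) (core∉ O)

  obstruction-∖ : ∀ {v} (O : Obstruction G) → v ∉ support O → Obstruction (G ∖ v)
  obstruction-∖ {G} O v∉ =
    obstruction (core O) (≼-∖ {core O} {G} (embedding O) v∉) (small O) (core∉ O)

  obstruction-addEdge : ∀ {a b v} (p : a ≢ b) (O : Obstruction G) → a ∉ support O ⊎ b ∉ support O →
                        v ∉ support O → Σ (Obstruction (addEdge G a b p)) λ O′ → v ∉ support O′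
  obstruction-addEdge {G} p O missing v∉ =
    obstruction (core O) (≼-addEdge-missing {core O} {G} (embedding O) p missing) (small O) (core∉ O) , v∉

  -- Choosing a witness for every pair of vertices, non-edge or not, gives a
  -- total family whose supports can be collected into one list.
  data EdgeWitness (G : Graph) (a b : Fin (size G)) : Set where
    not-a-non-edge : ¬ NonEdge G a b → EdgeWitness G a b
    obstructed     : (ab : NonEdge G a b) → Obstruction (addEdge G a b (proj₁ ab)) → EdgeWitness G a b

  witnessSupport : ∀ {a b} → EdgeWitness G a b → List (Fin (size G))
  witnessSupport (not-a-non-edge _) = []
  witnessSupport (obstructed _ O)   = support O

  length-witnessSupport : ∀ {a b} (w : EdgeWitness G a b) → length (witnessSupport w) ≤ k
  length-witnessSupport (not-a-non-edge _) = z≤n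
  length-witnessSupport (obstructed _ O)   = length-support O

  ¬¬edgeWitness : ¬ EdgeAdd 𝒢 G → ∀ a b → ¬ ¬ EdgeWitness G a b
  ¬¬edgeWitness {G} G∉ a b with nonEdge? G a b
  ... | no ¬ab = pure (not-a-non-edge ¬ab)
  ... | yes ab@(a≢b , ab∉E) =
    obstructed ab <$> ¬¬obstruction (λ G+ab∈ → G∉ (inj₂ (a , b , a≢b , ab∉E , G+ab∈)))

  witness⇒obstruction : ∀ {a b a′ b′ v} → a ≡ a′ → b ≡ b′ → (ab : NonEdge G a b) →
                        (w : EdgeWitness G a′ b′) → v ∉ witnessSupport w →
                        Σ (Obstruction (addEdge G a b (proj₁ ab))) λ O → v ∉ support O
  witness⇒obstruction refl refl ab (not-a-non-edge ¬ab) _  = contradiction ab ¬ab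
  witness⇒obstruction refl refl _  (obstructed _ O)     v∉ = O , v∉

  module _ {H} (proper∈ : ∀ H′ → H′ ≼ H → size H′ < size H → EdgeAdd 𝒢 H′)
           (O₁ : Obstruction H) (w : ∀ i j → EdgeWitness H (vertex O₁ i) (vertex O₁ j)) where

    obstructed-vertices : List (Fin (size H))
    obstructed-vertices = support O₁ ++ ⋃ λ i → ⋃ λ j → witnessSupport (w i j)

    length-obstructed-vertices : length obstructed-vertices ≤ k + k * (k * k)
    length-obstructed-vertices = ≤-trans (≤-reflexive (length-++ (support O₁)))
      (+-mono-≤ (length-support O₁)
        (≤-trans (length-⋃ λ i → length-⋃ λ j → length-witnessSupport (w i j))
                 (*-mono-≤ (small O₁) (*-monoˡ-≤ k (small O₁)))))

    non-edge-obstruction : ∀ {a b v} (ab : NonEdge H a b) → v ∉ obstructed-vertices →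
                           Σ (Obstruction (addEdge H a b (proj₁ ab))) λ O → v ∉ support O
    -- If a or b lies outside O₁, the new edge does not touch O₁.
    non-edge-obstruction {a} {b} ab v∉ with a ∈? support O₁ | b ∈? support O₁
    ... | no a∉  | _      = obstruction-addEdge (proj₁ ab) O₁ (inj₁ a∉) (v∉ ∘ ∈-++⁺ˡ)
    ... | yes _  | no b∉  = obstruction-addEdge (proj₁ ab) O₁ (inj₂ b∉) (v∉ ∘ ∈-++⁺ˡ)
    ... | yes a∈ | yes b∈ =
      let (i , a≡) = ∈-tabulate⁻ a∈
          (j , b≡) = ∈-tabulate⁻ b∈
      in witness⇒obstruction a≡ b≡ ab (w i j) (v∉ ∘ ∈-++⁺ʳ (support O₁) ∘ ∈-⋃⁺ i ∘ ∈-⋃⁺ j)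

    unobstructed-vertex⇒⊥ : ∀ {v} → v ∉ obstructed-vertices → ⊥
    unobstructed-vertex⇒⊥ {v} v∉ with proper∈ (H ∖ v) (∖-≼ {H} {v}) (∖-size {H} v)
    ... | inj₁ H∖v∈ = obstruction⇒∉ (obstruction-∖ O₁ (v∉ ∘ ∈-++⁺ˡ)) H∖v∈
    ... | inj₂ (c , d , c≢d , cd∉E , H∖v+cd∈) =
      let ab = (c≢d ∘ skip-injective v) , cd∉E
          (O , v∉O) = non-edge-obstruction ab v∉
      in obstruction⇒∉ (obstruction-≼ (∖-addEdge {H} c≢d (proj₁ ab)) (obstruction-∖ O v∉O)) H∖v+cd∈

  EdgeAdd-bounded : BoundedForbidden (EdgeAdd 𝒢) (k + k * (k * k))
  EdgeAdd-bounded H (H∉ , proper∈) = decidable-stable (size H ≤? k + k * (k * k)) do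
    O₁ ← ¬¬obstruction (H∉ ∘ inj₁)
    w ← ¬¬-Π _ λ i → ¬¬-Π _ λ j → ¬¬edgeWitness H∉ (vertex O₁ i) (vertex O₁ j)
    pure (≮⇒≥ λ N<H →
      let (v , v∉) = length<⇒∃∉ (obstructed-vertices proper∈ O₁ w)
                                (≤-<-trans (length-obstructed-vertices proper∈ O₁ w) N<H)
      in unobstructed-vertex⇒⊥ proper∈ O₁ w v∉)

theorem1p2 : (𝒢 : GraphClass) → Hereditary 𝒢 → HasFiniteForbidden 𝒢 →
    Hereditary (EdgeAdd 𝒢) × HasFiniteForbidden (EdgeAdd 𝒢)
theorem1p2 𝒢 hereditary finite =
  EdgeAdd-hereditary hereditary ,
  bounded⇒finite (EdgeAdd-bounded hereditary (proj₂ (finite⇒bounded finite)))
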